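{- Let $G$ be a connected graph with $|V(G)|\ge 3$, and let $H=\boldsymbol{R}(G,T,L,x,\{U_f\}_{f\in E(T)})$ be a rank-expansion of $G$. Then the matrix $A(H)[\overline{E_I(T)}]$ is nonsingular.
   Context: All graphs are finite and simple; $A(G)$ is the adjacency matrix over the binary field $GF(2)$; $M[X,Y]$ is the submatrix with rows $X$, columns $Y$, and $M[X]=M[X,X]$. In a tree $T$, a leaf is a vertex of degree $1$, other vertices are inner; $V_I(T)$ is the set of inner vertices, $E_I(T)$ the set of edges with no leaf as an end, and $\delta(v)$ the set of edges incident with $v$. A tree is subcubic if it has at least two vertices and every inner vertex has degree $3$. A rank-decomposition of $G$ is a pair $(T,L)$ with $T$ subcubic and $L$ a bijection from $V(G)$ to the leaves of $T$. Rank-expansion: let $(T,L)$ be a rank-decomposition of $G$ and $x$ a leaf of $T$; orient every edge of $T$ away from $x$. For $e\in E(T)$ let $T_e$ be the component of $T\setminus e$ not containing $x$, $A_e=L^{ -1}(V(T_e))$, $B_e=V(G)\setminus A_e$, $M_e=A(G)[A_e,B_e]$. Choose sets $U_e\subseteq A_e$ ($e\in E(T)$) such that (i) the rows of $M_e$ indexed by $U_e$ form a basis of the row space of $M_e$, and (ii) $U_e\cap A_f\subseteq U_f$ whenever the head of $e$ is the tail of $f$. Let $P_e$ be the unique $A_e\times U_e$ matrix over $GF(2)$ with $P_eA(G)[U_e,B_e]=A(G)[A_e,B_e]$. If the tail of $f$ is the head of $e$, let $C_f=P_e[U_f,U_e]$. The rank-expansion $H=\boldsymbol{R}(G,T,L,x,\{U_f\})$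 has vertex set $\bigcup_{v\in V_I(T)}S_v$, where $S_v=\bigcup_{e\in\delta(v)}U_e\times\{e\}\times\{v\}$, and edges: (a) $(a,e,v)(a,e,w)$ for every $e=vw\in E_I(T)$ and $a\in U_e$; (b) $(b,e,v)(a,f,v)$ whenever $v\in V_I(T)$ is the head of $e$ and the tail of $f$, $a\in U_f$, $b\in U_e$ and $(C_f)_{a,b}\ne 0$; (c) $(a,f_1,v)(b,f_2,v)$ whenever $v$ is the tail of two distinct edges $f_1,f_2$, $a\in U_{f_1}$, $b\in U_{f_2}$ and $ab\in E(G)$. For $e=vw\in E_I(T)$ let $\overline{e}=\{(a,e,v),(a,e,w):a\in U_e\}$, and for $W\subseteq E_I(T)$ let $\overline{W}=\bigcup_{e\in W}\overline{e}$. -}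

module Defs where

open import Data.Nat using (ℕ; zero; suc; _+_; _≤_; _≡ᵇ_)
open import Data.Fin using (Fin; zero; suc; inject₁; fromℕ; _≟_)
open import Data.Bool using (Bool; true; false; _∧_; _xor_; not; if_then_else_)
open import Data.Product using (Σ; _×_; _,_)
open import Data.Sum using (_⊎_)
open import Relation.Nullary using (¬_)
open import Relation.Nullary.Decidable using (⌊_⌋)
open import Relation.Binary.PropositionalEquality using (_≡_)

-- GF(2) is represented by Bool (addition = xor, multiplication = ∧).
-- A graph on k vertices is given by its adjacency matrix over GF(2).

Mat : ℕ → Set
Mat k = Fin k → Fin k → Bool

⊕Σ : ∀ {k} → (Fin k → Bool) → Bool
⊕Σ {zero} f = false
⊕Σ {suc k} f = f zero xor ⊕Σ (λ i → f (suc i))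

count : ∀ {k} → (Fin k → Bool) → ℕ
count {zero} f = 0
count {suc k} f = (if f zero then 1 else 0) + count (λ i → f (suc i))

IsSimpleGraph : ∀ {k} → Mat k → Set
IsSimpleGraph M = (∀ u v → M u v ≡ M v u) × (∀ u → M u u ≡ false)

data Reach {k : ℕ} (R : Fin k → Fin k → Set) : Fin k → Fin k → Set where
  here : ∀ {s} → Reach R s s
  step : ∀ {s t u} → R s t → Reach R t u → Reach R s u

Adj : ∀ {k} → Mat k → Fin k → Fin k → Set
Adj M u v = M u v ≡ true

Connected : ∀ {k} → Mat k → Set
Connected M = ∀ u v → Reach (Adj M) u v

HasCycle : ∀ {k} → Mat k → Set
HasCycle {k} M =
  Σ ℕ λ j → Σ (Fin (3 + j) → Fin k) λ c →
    (∀ i i' → c i ≡ c i' → i ≡ i')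
    × (∀ (i : Fin (2 + j)) → M (c (inject₁ i)) (c (suc i)) ≡ true)
    × (M (c (fromℕ (2 + j))) (c zero) ≡ true)

IsTree : ∀ {k} → Mat k → Set
IsTree M = IsSimpleGraph M × Connected M × ¬ HasCycle M

deg : ∀ {k} → Mat k → Fin k → ℕ
deg M v = count (M v)

isLeaf : ∀ {k} → Mat k → Fin k → Bool
isLeaf M v = deg M v ≡ᵇ 1

isInner : ∀ {k} → Mat k → Fin k → Bool
isInner M v = not (isLeaf M v)

IsSubcubicTree : ∀ {k} → Mat k → Set
IsSubcubicTree {k} M = IsTree M × 2 ≤ k × (∀ v → isInner M v ≡ true → deg M v ≡ 3)

IsLeafBijection : ∀ {n m} → Mat m → (Fin n → Fin m) → Set
IsLeafBijection {n} {m} T L =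
  (∀ a b → L a ≡ L b → a ≡ b)
  × (∀ a → isLeaf T (L a) ≡ true)
  × (∀ t → isLeaf T t ≡ true → Σ (Fin n) λ a → L a ≡ t)

IsRankDecomposition : ∀ {n m} → Mat n → Mat m → (Fin n → Fin m) → Set
IsRankDecomposition G T L = IsSubcubicTree T × IsLeafBijection T L

-- Rank-expansion data, relative to G, a rank-decomposition (T , L) and a
-- leaf x of T.  An edge e = vw of T is named by either ordered pair (v , w)
-- with T v w ≡ true.

module Expansion {n m : ℕ} (G : Mat n) (T : Mat m) (L : Fin n → Fin m) (x : Fin m) where

  SameEdge : Fin m → Fin m → Fin m → Fin m → Set
  SameEdge v w p q = (p ≡ v × q ≡ w) ⊎ (p ≡ w × q ≡ v)

  TMinus : Fin m → Fin m → Fin m → Fin m → Set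
  TMinus v w p q = (T p q ≡ true) × ¬ SameEdge v w p q

  -- t ∈ V(T_e) for e = vw: t lies in the component of T \ e not containing x
  InTe : Fin m → Fin m → Fin m → Set
  InTe v w t = ¬ Reach (TMinus v w) t x

  InA : Fin m → Fin m → Fin n → Set
  InA v w a = InTe v w (L a)

  -- the edge vw, oriented away from x, has tail v and head w
  Out : Fin m → Fin m → Set
  Out v w = (T v w ≡ true) × InTe v w w

  rowComb : (Fin n → Bool) → (Fin n → Bool) → Fin n → Bool
  rowComb S c b = ⊕Σ (λ u → S u ∧ (c u ∧ G u b))

  -- the rows of M = A(G)[A, V∖A] indexed by S form a basis of the row space of M
  IsRowBasis : (Fin n → Set) → (Fin n → Bool) → Set
  IsRowBasis A S =
    (∀ a → S a ≡ true → A a)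
    × (∀ a → A a → Σ (Fin n → Bool) λ c → ∀ b → ¬ A b → G a b ≡ rowComb S c b)
    × (∀ c → (∀ b → ¬ A b → rowComb S c b ≡ false) → ∀ u → S u ≡ true → c u ≡ false)

  -- U v w = U_e (indicator of a subset of V(G)) for e = vw; conditions (i),(ii)
  ValidU : (Fin m → Fin m → Fin n → Bool) → Set
  ValidU U =
    (∀ v w → T v w ≡ true → ∀ a → U v w a ≡ U w v a)
    × (∀ v w → T v w ≡ true → IsRowBasis (InA v w) (U v w))
    × (∀ u v w → Out u v → Out v w → ∀ a → U u v a ≡ true → InA v w a → U v w a ≡ true)

  -- P v w = P_e for e = vw (row index a ∈ A_e, column index u ∈ U_e):
  -- P_e A(G)[U_e, B_e] = A(G)[A_e, B_e].  (P_e is unique on A_e × U_e.)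
  ValidP : (Fin m → Fin m → Fin n → Bool) → (Fin m → Fin m → Fin n → Fin n → Bool) → Set
  ValidP U P =
    ∀ v w → T v w ≡ true → ∀ a → InA v w a → ∀ b → ¬ InA v w b →
      rowComb (U v w) (P v w a) b ≡ G a b

  -- A triple (a , v , w) stands for the vertex (a , e , v) of H with e = vw.
  Triple : Set
  Triple = Fin n × Fin m × Fin m

  module _ (U : Fin m → Fin m → Fin n → Bool) (P : Fin m → Fin m → Fin n → Fin n → Bool) where

    inEbar : Triple → Bool
    inEbar (a , v , w) = T v w ∧ (isInner T v ∧ (isInner T w ∧ U v w a))

    RuleA : Triple → Triple → Set
    RuleA (a , v , w) (a' , v' , w') =
      (a' ≡ a) × (v' ≡ w) × (w' ≡ v) × (T v w ≡ true)
      × (isInner T v ≡ true) × (isInner T w ≡ true) × (U v w a ≡ true)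

    -- rule (b): X = (b , e , v), e = uv with head v; Y = (a , f , v), f = vu' with tail v
    RuleB : Triple → Triple → Set
    RuleB (b , v , u) (a , v' , u') =
      (v' ≡ v) × Out u v × Out v u' × (isInner T v ≡ true)
      × (U v u b ≡ true) × (U v u' a ≡ true) × (P u v a b ≡ true)

    RuleC : Triple → Triple → Set
    RuleC (a , v , u₁) (b , v' , u₂) =
      (v' ≡ v) × ¬ (u₁ ≡ u₂) × Out v u₁ × Out v u₂ × (isInner T v ≡ true)
      × (U v u₁ a ≡ true) × (U v u₂ b ≡ true) × (G a b ≡ true)

    HAdj : Triple → Triple → Set
    HAdj X Y = RuleA X Y ⊎ RuleA Y X ⊎ RuleB X Y ⊎ RuleB Y X ⊎ RuleC X Y ⊎ RuleC Y X

    IsAdjMatrixOnEbar : (Triple → Triple → Bool) → Set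
    IsAdjMatrixOnEbar AH =
      ∀ X Y → inEbar X ≡ true → inEbar Y ≡ true →
        (AH X Y ≡ true → HAdj X Y) × (HAdj X Y → AH X Y ≡ true)

  ⊕Σ₃ : (Triple → Bool) → (Triple → Bool) → Bool
  ⊕Σ₃ S f = ⊕Σ (λ a → ⊕Σ (λ v → ⊕Σ (λ w → S (a , v , w) ∧ f (a , v , w))))

  eqTriple : Triple → Triple → Bool
  eqTriple (a , v , w) (a' , v' , w') = ⌊ a ≟ a' ⌋ ∧ (⌊ v ≟ v' ⌋ ∧ ⌊ w ≟ w' ⌋)

  NonsingularOn : (Triple → Bool) → (Triple → Triple → Bool) → Set
  NonsingularOn S M =
    Σ (Triple → Triple → Bool) λ N →
      (∀ X Y → S X ≡ true → S Y ≡ true → ⊕Σ₃ S (λ Z → M X Z ∧ N Z Y) ≡ eqTriple X Y)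
      × (∀ X Y → S X ≡ true → S Y ≡ true → ⊕Σ₃ S (λ Z → N X Z ∧ M Z Y) ≡ eqTriple X Y)

module Submission where

-- Rule (a) pairs every vertex (a , e , v) of Ē with its partner (a , e , w), e = vw.
-- Orient T away from x.  A copy at the head v of e is adjacent, besides its partner, only to
-- copies at v of edges leaving v (rule (b)).  Hence every nonempty partner-closed S ⊆ Ē has a
-- pendant element Y: its row of A(H)[S] is the unit vector at its partner X (follow rule-(b)
-- edges away from x until none is left).  Deleting such a pendant pair {X , Y} preserves
-- nonsingularity (a Schur complement), and induction on |S| gives the lemma.

open import Defs
open import Algebra.Bundles using (CommutativeRing)
open import Data.Bool using (Bool; true; false; not; _∧_; _xor_; if_then_else_)
open import Data.Bool.Properties
  using (xor-∧-commutativeRing; ∧-commutativeMonoid; ∧-comm; ∧-assoc; ∧-zeroʳ; ∧-identityʳ; ∧-conicalˡ;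
         ∧-conicalʳ; xor-same; xor-identityʳ; ⇔→≡)
  renaming (_≟_ to _≟ᵇ_)
open import Data.Empty using (⊥; ⊥-elim)
open import Data.Fin using (Fin; zero; suc; _≟_)
open import Data.Fin.Properties using (any?; all?)
open import Data.Nat using (ℕ; zero; suc; _≤_; _<_; z≤n; s≤s)
open import Data.Nat.Properties
  using (≤-refl; <-≤-trans; n<1+n; +-mono-≤; +-mono-<-≤; +-mono-≤-<; +-0-commutativeMonoid)
open import Data.Product using (Σ; _×_; _,_; proj₁; proj₂)
open import Data.Sum using (_⊎_; inj₁; inj₂; swap)
open import Function using (mk⇔)
open import Relation.Binary.PropositionalEquality
open import Relation.Nullary using (¬_; Dec; yes; no; does)
open import Relation.Nullary.Decidable
  using (⌊_⌋; map′; _×-dec_; _⊎-dec_; _→-dec_; ¬¬-excluded-middle; dec-true; dec-false)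

open CommutativeRing xor-∧-commutativeRing using (semiring)
open import Algebra.Properties.Semiring.Sum semiring
  using (sum; sum-cong-≗)
  renaming (∑-distrib-+ to sum-distrib-xor; ∑-comm to sum-comm; *-distribˡ-sum to ∧-distribˡ-sum)
open import Algebra.Properties.CommutativeMonoid.Sum +-0-commutativeMonoid using () renaming (sum to sumℕ)
open import Algebra.Solver.CommutativeMonoid ∧-commutativeMonoid using (solve; _⊕_; _⊜_)

⊕Σ≡sum : ∀ {k} (f : Fin k → Bool) → ⊕Σ f ≡ sum f
⊕Σ≡sum {zero} f = refl
⊕Σ≡sum {suc k} f = cong (f zero xor_) (⊕Σ≡sum (λ i → f (suc i)))

⊕Σ-cong : ∀ {k} {f g : Fin k → Bool} → (∀ i → f i ≡ g i) → ⊕Σ f ≡ ⊕Σ g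
⊕Σ-cong {f = f} {g} f≗g = trans (⊕Σ≡sum f) (trans (sum-cong-≗ f≗g) (sym (⊕Σ≡sum g)))

⊕Σ-∧ˡ : ∀ {k} b (f : Fin k → Bool) → ⊕Σ (λ i → b ∧ f i) ≡ b ∧ ⊕Σ f
⊕Σ-∧ˡ b f = trans (⊕Σ≡sum (λ i → b ∧ f i)) (trans (sym (∧-distribˡ-sum b f)) (cong (b ∧_) (sym (⊕Σ≡sum f))))

⊕Σ-false : ∀ {k} → ⊕Σ {k} (λ _ → false) ≡ false
⊕Σ-false {k} = ⊕Σ-∧ˡ {k} false (λ _ → false)

⌊≟⌋-refl : ∀ {k} (i : Fin k) → ⌊ i ≟ i ⌋ ≡ true
⌊≟⌋-refl i with i ≟ i
... | yes _ = refl
... | no i≢i = ⊥-elim (i≢i refl)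

⌊suc≟suc⌋ : ∀ {k} (i j : Fin k) → ⌊ suc i ≟ suc j ⌋ ≡ ⌊ i ≟ j ⌋
⌊suc≟suc⌋ i j with i ≟ j
... | yes _ = refl
... | no _ = refl

⊕Σ-delta : ∀ {k} (i : Fin k) (f : Fin k → Bool) → ⊕Σ (λ j → ⌊ i ≟ j ⌋ ∧ f j) ≡ f i
⊕Σ-delta {suc k} zero f = trans (cong (f zero xor_) (⊕Σ-false {k})) (xor-identityʳ (f zero))
⊕Σ-delta {suc k} (suc i) f =
  trans (⊕Σ-cong (λ j → cong (_∧ f (suc j)) (⌊suc≟suc⌋ i j))) (⊕Σ-delta i (λ j → f (suc j)))

⊕Σ-delta-scaled : ∀ {k} b (i : Fin k) (f : Fin k → Bool) → ⊕Σ (λ j → b ∧ (⌊ i ≟ j ⌋ ∧ f j)) ≡ b ∧ f i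
⊕Σ-delta-scaled b i f = trans (⊕Σ-∧ˡ b (λ j → ⌊ i ≟ j ⌋ ∧ f j)) (cong (b ∧_) (⊕Σ-delta i f))

⊕Σ-xor : ∀ {k} (f g : Fin k → Bool) → ⊕Σ (λ i → f i xor g i) ≡ ⊕Σ f xor ⊕Σ g
⊕Σ-xor f g =
  trans (⊕Σ≡sum (λ i → f i xor g i))
        (trans (sum-distrib-xor f g) (sym (cong₂ _xor_ (⊕Σ≡sum f) (⊕Σ≡sum g))))

⊕Σ-comm : ∀ {k l} (h : Fin k → Fin l → Bool) →
  ⊕Σ (λ i → ⊕Σ (λ j → h i j)) ≡ ⊕Σ (λ j → ⊕Σ (λ i → h i j))
⊕Σ-comm h = trans (as-sum h) (trans (sum-comm h) (sym (as-sum (λ j i → h i j))))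
  where
  as-sum : ∀ {k l} (h : Fin k → Fin l → Bool) → ⊕Σ (λ i → ⊕Σ (h i)) ≡ sum (λ i → sum (h i))
  as-sum h = trans (⊕Σ≡sum (λ i → ⊕Σ (h i))) (sum-cong-≗ (λ i → ⊕Σ≡sum (h i)))

true≢false : true ≢ false
true≢false ()

record GF2Summation (I : Set) : Set where
  field
    _≐_     : I → I → Bool
    ≐-refl  : ∀ i → (i ≐ i) ≡ true
    ≐-sound : ∀ {i j} → (i ≐ j) ≡ true → i ≡ j
    ∑       : (I → Bool) → Bool
    ∑-cong  : ∀ {f g : I → Bool} → (∀ i → f i ≡ g i) → ∑ f ≡ ∑ g
    ∑-xor   : ∀ (f g : I → Bool) → ∑ (λ i → f i xor g i) ≡ ∑ f xor ∑ g
    ∑-∧ˡ    : ∀ b (f : I → Bool) → ∑ (λ i → b ∧ f i) ≡ b ∧ ∑ f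
    ∑-comm  : ∀ (h : I → I → Bool) → ∑ (λ i → ∑ (λ j → h i j)) ≡ ∑ (λ j → ∑ (λ i → h i j))
    ∑-delta : ∀ i (f : I → Bool) → ∑ (λ j → (i ≐ j) ∧ f j) ≡ f i

module MatrixAlgebra {I : Set} (Sum : GF2Summation I) where
  open GF2Summation Sum
  open ≡-Reasoning

  ≐-false : ∀ {i j} → ¬ i ≡ j → (i ≐ j) ≡ false
  ≐-false {i} {j} i≢j with i ≐ j in i≐j
  ... | true = ⊥-elim (i≢j (≐-sound i≐j))
  ... | false = refl

  ≐-false⁻ : ∀ {i j} → (i ≐ j) ≡ false → ¬ i ≡ j
  ≐-false⁻ {i} i≐j refl = true≢false (trans (sym (≐-refl i)) i≐j)

  ≐-sym : ∀ i j → (i ≐ j) ≡ (j ≐ i)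
  ≐-sym i j with i ≐ j in i≐j
  ... | true with ≐-sound i≐j
  ...   | refl = sym (≐-refl i)
  ≐-sym i j | false = sym (≐-false (λ j≡i → ≐-false⁻ i≐j (sym j≡i)))

  Subset : Set
  Subset = I → Bool

  ∑∈ : Subset → (I → Bool) → Bool
  ∑∈ S f = ∑ (λ Z → S Z ∧ f Z)

  ∑∈-cong : ∀ S {f g : I → Bool} → (∀ Z → S Z ≡ true → f Z ≡ g Z) → ∑∈ S f ≡ ∑∈ S g
  ∑∈-cong S {f} {g} f≗g = ∑-cong pointwise
    where
    pointwise : ∀ Z → S Z ∧ f Z ≡ S Z ∧ g Z
    pointwise Z with S Z in Z∈S
    ... | true = f≗g Z Z∈S
    ... | false = refl

  ∑∈-vanish : ∀ S (f : I → Bool) → (∀ Z → S Z ≡ true → f Z ≡ false) → ∑∈ S f ≡ false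
  ∑∈-vanish S f f≗0 = begin
    ∑∈ S f                        ≡⟨ ∑∈-cong S f≗0 ⟩
    ∑ (λ Z → S Z ∧ false)         ≡⟨ ∑-cong (λ Z → ∧-zeroʳ (S Z)) ⟩
    ∑ (λ _ → false ∧ false)       ≡⟨ ∑-∧ˡ false (λ _ → false) ⟩
    false                         ∎

  ∑-∧ʳ : ∀ b (f : I → Bool) → ∑ (λ Z → f Z ∧ b) ≡ ∑ f ∧ b
  ∑-∧ʳ b f = begin
    ∑ (λ Z → f Z ∧ b)   ≡⟨ ∑-cong (λ Z → ∧-comm (f Z) b) ⟩
    ∑ (λ Z → b ∧ f Z)   ≡⟨ ∑-∧ˡ b f ⟩
    b ∧ ∑ f             ≡⟨ ∧-comm b (∑ f) ⟩
    ∑ f ∧ b             ∎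

  ∑∈-delta : ∀ S {i} (f : I → Bool) → S i ≡ true → ∑∈ S (λ j → (i ≐ j) ∧ f j) ≡ f i
  ∑∈-delta S {i} f i∈S = trans (∑-cong pointwise) (∑-delta i f)
    where
    pointwise : ∀ j → S j ∧ ((i ≐ j) ∧ f j) ≡ (i ≐ j) ∧ f j
    pointwise j with i ≐ j in i≐j
    ... | false = ∧-zeroʳ (S j)
    ... | true rewrite sym (≐-sound i≐j) | i∈S = refl

  ∑∈-delta′ : ∀ S {i} (f : I → Bool) → S i ≡ true → ∑∈ S (λ j → f j ∧ (j ≐ i)) ≡ f i
  ∑∈-delta′ S {i} f i∈S =
    trans (∑∈-cong S (λ j _ → trans (∧-comm (f j) (j ≐ i)) (cong (_∧ f j) (≐-sym j i))))
          (∑∈-delta S f i∈S)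

  ∑∈-assoc : ∀ S (a : I → Bool) (B : I → I → Bool) (c : I → Bool) →
    ∑∈ S (λ Z → ∑∈ S (λ U → a U ∧ B U Z) ∧ c Z) ≡ ∑∈ S (λ U → a U ∧ ∑∈ S (λ Z → B U Z ∧ c Z))
  ∑∈-assoc S a B c = begin
    ∑∈ S (λ Z → ∑∈ S (λ U → a U ∧ B U Z) ∧ c Z)
      ≡⟨ ∑-cong (λ Z → cong (S Z ∧_) (sym (∑-∧ʳ (c Z) (λ U → S U ∧ (a U ∧ B U Z))))) ⟩
    ∑ (λ Z → S Z ∧ ∑ (λ U → (S U ∧ (a U ∧ B U Z)) ∧ c Z))
      ≡⟨ ∑-cong (λ Z → sym (∑-∧ˡ (S Z) (λ U → (S U ∧ (a U ∧ B U Z)) ∧ c Z))) ⟩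
    ∑ (λ Z → ∑ (λ U → S Z ∧ ((S U ∧ (a U ∧ B U Z)) ∧ c Z)))
      ≡⟨ ∑-comm (λ Z U → S Z ∧ ((S U ∧ (a U ∧ B U Z)) ∧ c Z)) ⟩
    ∑ (λ U → ∑ (λ Z → S Z ∧ ((S U ∧ (a U ∧ B U Z)) ∧ c Z)))
      ≡⟨ ∑-cong (λ U → ∑-cong (λ Z → solve 5 (λ s t a b c → s ⊕ ((t ⊕ (a ⊕ b)) ⊕ c) ⊜ (t ⊕ a) ⊕ (s ⊕ (b ⊕ c)))
                                             refl (S Z) (S U) (a U) (B U Z) (c Z))) ⟩
    ∑ (λ U → ∑ (λ Z → (S U ∧ a U) ∧ (S Z ∧ (B U Z ∧ c Z))))
      ≡⟨ ∑-cong (λ U → trans (∑-∧ˡ (S U ∧ a U) (λ Z → S Z ∧ (B U Z ∧ c Z)))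
                             (∧-assoc (S U) (a U) (∑∈ S (λ Z → B U Z ∧ c Z)))) ⟩
    ∑∈ S (λ U → a U ∧ ∑∈ S (λ Z → B U Z ∧ c Z))
      ∎

  remove₂ : Subset → I → I → Subset
  remove₂ S X Y Z = S Z ∧ (not (X ≐ Z) ∧ not (Y ≐ Z))

  remove₂-intro : ∀ S {X Y Z} → S Z ≡ true → ¬ X ≡ Z → ¬ Y ≡ Z → remove₂ S X Y Z ≡ true
  remove₂-intro S {X} {Y} {Z} Z∈S X≢Z Y≢Z =
    trans (cong₂ (λ p q → S Z ∧ (not p ∧ not q)) (≐-false X≢Z) (≐-false Y≢Z)) (trans (∧-identityʳ (S Z)) Z∈S)

  remove₂-elim : ∀ S {X Y Z} → remove₂ S X Y Z ≡ true → (S Z ≡ true) × ¬ X ≡ Z × ¬ Y ≡ Z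
  remove₂-elim S {X} {Y} {Z} Z∈S′ with S Z | X ≐ Z in X≐Z | Y ≐ Z in Y≐Z
  ... | true  | false | false = refl , ≐-false⁻ X≐Z , ≐-false⁻ Y≐Z
  ... | true  | true  | _     = ⊥-elim (true≢false (sym Z∈S′))
  ... | true  | false | true  = ⊥-elim (true≢false (sym Z∈S′))
  ... | false | _     | _     = ⊥-elim (true≢false (sym Z∈S′))

  -- the Boolean identity behind splitting off the terms at X and at Y a sum into the terms at X, at Y and the rest
  split-bool : ∀ s ex ey h → (ex ≡ true → s ≡ true) → (ey ≡ true → s ≡ true) → (ex ≡ true → ey ≡ false) →
    s ∧ h ≡ (ex ∧ h) xor ((ey ∧ h) xor ((s ∧ (not ex ∧ not ey)) ∧ h))
  split-bool s true ey h x→s _ x→¬y rewrite x→s refl | x→¬y refl = sym (xor-identityʳ h)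
  split-bool s false true h _ y→s _ rewrite y→s refl = sym (xor-identityʳ h)
  split-bool s false false h _ _ _ = cong (_∧ h) (sym (∧-identityʳ s))

  ∑∈-remove₂ : ∀ S {X Y} (h : I → Bool) → S X ≡ true → S Y ≡ true → ¬ X ≡ Y →
    ∑∈ S h ≡ h X xor (h Y xor ∑∈ (remove₂ S X Y) h)
  ∑∈-remove₂ S {X} {Y} h X∈S Y∈S X≢Y = begin
    ∑ (λ Z → S Z ∧ h Z)
      ≡⟨ ∑-cong (λ Z → split-bool (S Z) (X ≐ Z) (Y ≐ Z) (h Z) (member X∈S) (member Y∈S) (only-X Z)) ⟩
    ∑ (λ Z → ((X ≐ Z) ∧ h Z) xor (((Y ≐ Z) ∧ h Z) xor (remove₂ S X Y Z ∧ h Z)))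
      ≡⟨ ∑-xor (λ Z → (X ≐ Z) ∧ h Z) (λ Z → ((Y ≐ Z) ∧ h Z) xor (remove₂ S X Y Z ∧ h Z)) ⟩
    ∑ (λ Z → (X ≐ Z) ∧ h Z) xor ∑ (λ Z → ((Y ≐ Z) ∧ h Z) xor (remove₂ S X Y Z ∧ h Z))
      ≡⟨ cong₂ _xor_ (∑-delta X h) (∑-xor (λ Z → (Y ≐ Z) ∧ h Z) (λ Z → remove₂ S X Y Z ∧ h Z)) ⟩
    h X xor (∑ (λ Z → (Y ≐ Z) ∧ h Z) xor ∑∈ (remove₂ S X Y) h)
      ≡⟨ cong (λ t → h X xor (t xor ∑∈ (remove₂ S X Y) h)) (∑-delta Y h) ⟩
    h X xor (h Y xor ∑∈ (remove₂ S X Y) h)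
      ∎
    where
    member : ∀ {W} → S W ≡ true → ∀ {Z} → (W ≐ Z) ≡ true → S Z ≡ true
    member W∈S W≐Z = subst (λ Z → S Z ≡ true) (≐-sound W≐Z) W∈S
    only-X : ∀ Z → (X ≐ Z) ≡ true → (Y ≐ Z) ≡ false
    only-X Z X≐Z = ≐-false (λ Y≡Z → X≢Y (trans (≐-sound X≐Z) (sym Y≡Z)))

  Matrix : Set
  Matrix = I → I → Bool

  _ᵀ : Matrix → Matrix
  (M ᵀ) X Y = M Y X

  RightInverseOn : Subset → Matrix → Matrix → Set
  RightInverseOn S M N = ∀ X Y → S X ≡ true → S Y ≡ true → ∑∈ S (λ Z → M X Z ∧ N Z Y) ≡ (X ≐ Y)

  Nonsingular : Subset → Matrix → Set
  Nonsingular S M = Σ Matrix λ N → RightInverseOn S M N × RightInverseOn S N M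

  transpose-inverse : ∀ S {M N} → RightInverseOn S M N → RightInverseOn S (N ᵀ) (M ᵀ)
  transpose-inverse S {M} {N} MN X Y X∈S Y∈S = begin
    ∑∈ S (λ Z → N Z X ∧ M Y Z)   ≡⟨ ∑∈-cong S (λ Z _ → ∧-comm (N Z X) (M Y Z)) ⟩
    ∑∈ S (λ Z → M Y Z ∧ N Z X)   ≡⟨ MN Y X Y∈S X∈S ⟩
    (Y ≐ X)                      ≡⟨ ≐-sym Y X ⟩
    (X ≐ Y)                      ∎

  -- a right inverse N and a left inverse K of M[S] agree on S (K = K M N = N),
  -- so N is a left inverse as well
  right-inverse-is-left : ∀ S {M N K} → RightInverseOn S M N → RightInverseOn S K M → RightInverseOn S N M
  right-inverse-is-left S {M} {N} {K} MN KM X Y X∈S Y∈S = begin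
    ∑∈ S (λ Z → N X Z ∧ M Z Y)   ≡⟨ ∑∈-cong S (λ Z Z∈S → cong (_∧ M Z Y) (K≗N X Z X∈S Z∈S)) ⟨
    ∑∈ S (λ Z → K X Z ∧ M Z Y)   ≡⟨ KM X Y X∈S Y∈S ⟩
    (X ≐ Y)                      ∎
    where
    K≗N : ∀ W V → S W ≡ true → S V ≡ true → K W V ≡ N W V
    K≗N W V W∈S V∈S = begin
      K W V                                              ≡⟨ ∑∈-delta′ S (K W) V∈S ⟨
      ∑∈ S (λ Z → K W Z ∧ (Z ≐ V))                       ≡⟨ ∑∈-cong S (λ Z Z∈S → cong (K W Z ∧_) (MN Z V Z∈S V∈S)) ⟨
      ∑∈ S (λ Z → K W Z ∧ ∑∈ S (λ U → M Z U ∧ N U V))    ≡⟨ ∑∈-assoc S (K W) M (λ U → N U V) ⟨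
      ∑∈ S (λ U → ∑∈ S (λ Z → K W Z ∧ M Z U) ∧ N U V)    ≡⟨ ∑∈-cong S (λ U U∈S → cong (_∧ N U V) (KM W U W∈S U∈S)) ⟩
      ∑∈ S (λ U → (W ≐ U) ∧ N U V)                       ≡⟨ ∑∈-delta S (λ U → N U V) W∈S ⟩
      N W V                                              ∎

  xor-cancel : ∀ a b → a xor ((a xor b) xor b) ≡ false
  xor-cancel true true = refl
  xor-cancel true false = refl
  xor-cancel false true = refl
  xor-cancel false false = refl

  xor₃-cong : ∀ {a a′ b b′ c c′} → a ≡ a′ → b ≡ b′ → c ≡ c′ → a xor (b xor c) ≡ a′ xor (b′ xor c′)
  xor₃-cong p q r = cong₂ _xor_ p (cong₂ _xor_ q r)

  -- In block form with respect to X, Y and S′ = S ∖ {X , Y},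
  --          X  Y  S′                   X  Y  S′
  --   M = [  m  1  r  ] X         N = [ 0  1  0  ] X       ρ = r N′,   π = N′ c,
  --       [  1  0  0  ] Y             [ 1  δ  ρ  ] Y       δ = m + r N′ c,
  --       [  c  0  M′ ] S′            [ 0  π  N′ ] S′
  -- and M N = 1 on S whenever M′ N′ = 1 on S′.
  module PendantPair (S : Subset) (M : Matrix) {X Y : I}
    (X∈S : S X ≡ true) (Y∈S : S Y ≡ true) (X≢Y : ¬ X ≡ Y)
    (row-Y : ∀ Z → S Z ≡ true → M Y Z ≡ (X ≐ Z))
    (col-Y : ∀ Z → S Z ≡ true → M Z Y ≡ (X ≐ Z))
    (N′ : Matrix) where

    S′ : Subset
    S′ = remove₂ S X Y

    π : I → Bool
    π Z = ∑∈ S′ (λ U → N′ Z U ∧ M U X)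

    ρ : I → Bool
    ρ V = ∑∈ S′ (λ U → M X U ∧ N′ U V)

    δ : Bool
    δ = M X X xor ∑∈ S′ (λ U → M X U ∧ π U)

    extend : Matrix
    extend Z V =
      if X ≐ Z then Y ≐ V else
      if X ≐ V then Y ≐ Z else
      if Y ≐ Z then (if Y ≐ V then δ else ρ V) else
      if Y ≐ V then π Z else N′ Z V

    X≐Y : (X ≐ Y) ≡ false
    X≐Y = ≐-false X≢Y

    in-S′ : ∀ {Z} → S′ Z ≡ true → ((X ≐ Z) ≡ false) × ((Y ≐ Z) ≡ false)
    in-S′ Z∈S′ = let _ , X≢Z , Y≢Z = remove₂-elim S Z∈S′ in ≐-false X≢Z , ≐-false Y≢Z

    data Position (Z : I) : Set where
      at-X    : Z ≡ X → Position Z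
      at-Y    : Z ≡ Y → Position Z
      in-rest : S′ Z ≡ true → Position Z

    position : ∀ {Z} → S Z ≡ true → Position Z
    position {Z} Z∈S with X ≐ Z in X≐Z | Y ≐ Z in Y≐Z
    ... | true  | _     = at-X (sym (≐-sound X≐Z))
    ... | false | true  = at-Y (sym (≐-sound Y≐Z))
    ... | false | false = in-rest (remove₂-intro S Z∈S (≐-false⁻ X≐Z) (≐-false⁻ Y≐Z))

    extend-X· : ∀ V → extend X V ≡ (Y ≐ V)
    extend-X· V rewrite ≐-refl X = refl

    extend-·X : ∀ {Z} → (X ≐ Z) ≡ false → extend Z X ≡ (Y ≐ Z)
    extend-·X X≐Z rewrite X≐Z | ≐-refl X = refl

    extend-YY : extend Y Y ≡ δ
    extend-YY rewrite X≐Y | ≐-refl Y = refl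

    extend-Y· : ∀ {V} → S′ V ≡ true → extend Y V ≡ ρ V
    extend-Y· V∈S′ rewrite X≐Y | proj₁ (in-S′ V∈S′) | ≐-refl Y | proj₂ (in-S′ V∈S′) = refl

    extend-·Y : ∀ {Z} → S′ Z ≡ true → extend Z Y ≡ π Z
    extend-·Y Z∈S′ rewrite proj₁ (in-S′ Z∈S′) | X≐Y | proj₂ (in-S′ Z∈S′) | ≐-refl Y = refl

    extend-S′ : ∀ {Z V} → S′ Z ≡ true → S′ V ≡ true → extend Z V ≡ N′ Z V
    extend-S′ Z∈S′ V∈S′
      rewrite proj₁ (in-S′ Z∈S′) | proj₁ (in-S′ V∈S′) | proj₂ (in-S′ Z∈S′) | proj₂ (in-S′ V∈S′) = refl

    expand : ∀ {W} V → S W ≡ true →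
      ∑∈ S (λ Z → M W Z ∧ extend Z V)
        ≡ (M W X ∧ (Y ≐ V)) xor (((X ≐ W) ∧ extend Y V) xor ∑∈ S′ (λ Z → M W Z ∧ extend Z V))
    expand {W} V W∈S =
      trans (∑∈-remove₂ S (λ Z → M W Z ∧ extend Z V) X∈S Y∈S X≢Y)
            (xor₃-cong (cong (M W X ∧_) (extend-X· V)) (cong (_∧ extend Y V) (col-Y W W∈S)) refl)

    module _ (MN′ : RightInverseOn S′ M N′) where

      -- M′ π = M′ N′ c = c on S′
      through-N′ : ∀ {W} → S′ W ≡ true → ∑∈ S′ (λ Z → M W Z ∧ π Z) ≡ M W X
      through-N′ {W} W∈S′ = begin
        ∑∈ S′ (λ Z → M W Z ∧ ∑∈ S′ (λ U → N′ Z U ∧ M U X))   ≡⟨ ∑∈-assoc S′ (M W) N′ (λ U → M U X) ⟨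
        ∑∈ S′ (λ U → ∑∈ S′ (λ Z → M W Z ∧ N′ Z U) ∧ M U X)   ≡⟨ ∑∈-cong S′ (λ U U∈S′ → cong (_∧ M U X) (MN′ W U W∈S′ U∈S′)) ⟩
        ∑∈ S′ (λ U → (W ≐ U) ∧ M U X)                        ≡⟨ ∑∈-delta S′ (λ U → M U X) W∈S′ ⟩
        M W X                                                ∎

      row-Y-case : ∀ V → ∑∈ S (λ Z → M Y Z ∧ extend Z V) ≡ (Y ≐ V)
      row-Y-case V = begin
        ∑∈ S (λ Z → M Y Z ∧ extend Z V)     ≡⟨ ∑∈-cong S (λ Z Z∈S → cong (_∧ extend Z V) (row-Y Z Z∈S)) ⟩
        ∑∈ S (λ Z → (X ≐ Z) ∧ extend Z V)   ≡⟨ ∑∈-delta S (λ Z → extend Z V) X∈S ⟩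
        extend X V                          ≡⟨ extend-X· V ⟩
        (Y ≐ V)                             ∎

      column-X-case : ∀ {W} → S W ≡ true → ∑∈ S (λ Z → M W Z ∧ extend Z X) ≡ (W ≐ X)
      column-X-case {W} W∈S = begin
        ∑∈ S (λ Z → M W Z ∧ extend Z X)
          ≡⟨ expand X W∈S ⟩
        (M W X ∧ (Y ≐ X)) xor (((X ≐ W) ∧ extend Y X) xor ∑∈ S′ (λ Z → M W Z ∧ extend Z X))
          ≡⟨ xor₃-cong (trans (cong (M W X ∧_) (trans (≐-sym Y X) X≐Y)) (∧-zeroʳ (M W X)))
                       (trans (cong ((X ≐ W) ∧_) (trans (extend-·X X≐Y) (≐-refl Y))) (∧-identityʳ (X ≐ W)))
                       (∑∈-vanish S′ _ (λ Z Z∈S′ →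
                          trans (cong (M W Z ∧_) (trans (extend-·X (proj₁ (in-S′ Z∈S′))) (proj₂ (in-S′ Z∈S′))))
                                (∧-zeroʳ (M W Z)))) ⟩
        false xor ((X ≐ W) xor false)
          ≡⟨ xor-identityʳ (X ≐ W) ⟩
        (X ≐ W)
          ≡⟨ ≐-sym X W ⟩
        (W ≐ X)
          ∎

      X-Y-case : ∑∈ S (λ Z → M X Z ∧ extend Z Y) ≡ (X ≐ Y)
      X-Y-case = begin
        ∑∈ S (λ Z → M X Z ∧ extend Z Y)
          ≡⟨ expand Y X∈S ⟩
        (M X X ∧ (Y ≐ Y)) xor (((X ≐ X) ∧ extend Y Y) xor ∑∈ S′ (λ Z → M X Z ∧ extend Z Y))
          ≡⟨ xor₃-cong (trans (cong (M X X ∧_) (≐-refl Y)) (∧-identityʳ (M X X)))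
                       (cong₂ _∧_ (≐-refl X) extend-YY)
                       (∑∈-cong S′ (λ Z Z∈S′ → cong (M X Z ∧_) (extend-·Y Z∈S′))) ⟩
        M X X xor (δ xor ∑∈ S′ (λ Z → M X Z ∧ π Z))
          ≡⟨ xor-cancel (M X X) (∑∈ S′ (λ Z → M X Z ∧ π Z)) ⟩
        false
          ≡⟨ X≐Y ⟨
        (X ≐ Y)
          ∎

      X-rest-case : ∀ {V} → S′ V ≡ true → ∑∈ S (λ Z → M X Z ∧ extend Z V) ≡ (X ≐ V)
      X-rest-case {V} V∈S′ = begin
        ∑∈ S (λ Z → M X Z ∧ extend Z V)
          ≡⟨ expand V X∈S ⟩
        (M X X ∧ (Y ≐ V)) xor (((X ≐ X) ∧ extend Y V) xor ∑∈ S′ (λ Z → M X Z ∧ extend Z V))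
          ≡⟨ xor₃-cong (trans (cong (M X X ∧_) (proj₂ (in-S′ V∈S′))) (∧-zeroʳ (M X X)))
                       (cong₂ _∧_ (≐-refl X) (extend-Y· V∈S′))
                       (∑∈-cong S′ (λ Z Z∈S′ → cong (M X Z ∧_) (extend-S′ Z∈S′ V∈S′))) ⟩
        false xor (ρ V xor ρ V)
          ≡⟨ xor-same (ρ V) ⟩
        false
          ≡⟨ proj₁ (in-S′ V∈S′) ⟨
        (X ≐ V)
          ∎

      rest-Y-case : ∀ {W} → S′ W ≡ true → ∑∈ S (λ Z → M W Z ∧ extend Z Y) ≡ (W ≐ Y)
      rest-Y-case {W} W∈S′ = begin
        ∑∈ S (λ Z → M W Z ∧ extend Z Y)
          ≡⟨ expand Y (∧-conicalˡ (S W) _ W∈S′) ⟩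
        (M W X ∧ (Y ≐ Y)) xor (((X ≐ W) ∧ extend Y Y) xor ∑∈ S′ (λ Z → M W Z ∧ extend Z Y))
          ≡⟨ xor₃-cong (trans (cong (M W X ∧_) (≐-refl Y)) (∧-identityʳ (M W X)))
                       (cong (_∧ extend Y Y) (proj₁ (in-S′ W∈S′)))
                       (trans (∑∈-cong S′ (λ Z Z∈S′ → cong (M W Z ∧_) (extend-·Y Z∈S′))) (through-N′ W∈S′)) ⟩
        M W X xor (false xor M W X)
          ≡⟨ xor-same (M W X) ⟩
        false
          ≡⟨ trans (≐-sym W Y) (proj₂ (in-S′ W∈S′)) ⟨
        (W ≐ Y)
          ∎

      rest-rest-case : ∀ {W V} → S′ W ≡ true → S′ V ≡ true → ∑∈ S (λ Z → M W Z ∧ extend Z V) ≡ (W ≐ V)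
      rest-rest-case {W} {V} W∈S′ V∈S′ = begin
        ∑∈ S (λ Z → M W Z ∧ extend Z V)
          ≡⟨ expand V (∧-conicalˡ (S W) _ W∈S′) ⟩
        (M W X ∧ (Y ≐ V)) xor (((X ≐ W) ∧ extend Y V) xor ∑∈ S′ (λ Z → M W Z ∧ extend Z V))
          ≡⟨ xor₃-cong (trans (cong (M W X ∧_) (proj₂ (in-S′ V∈S′))) (∧-zeroʳ (M W X)))
                       (cong (_∧ extend Y V) (proj₁ (in-S′ W∈S′)))
                       (trans (∑∈-cong S′ (λ Z Z∈S′ → cong (M W Z ∧_) (extend-S′ Z∈S′ V∈S′))) (MN′ W V W∈S′ V∈S′)) ⟩
        false xor (false xor (W ≐ V))
          ≡⟨⟩
        (W ≐ V)
          ∎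

      right-inverse : RightInverseOn S M extend
      right-inverse W V W∈S V∈S with position W∈S | position V∈S
      ... | at-Y refl      | _              = row-Y-case V
      ... | _              | at-X refl      = column-X-case W∈S
      ... | at-X refl      | at-Y refl      = X-Y-case
      ... | at-X refl      | in-rest V∈S′   = X-rest-case V∈S′
      ... | in-rest W∈S′   | at-Y refl      = rest-Y-case W∈S′
      ... | in-rest W∈S′   | in-rest V∈S′   = rest-rest-case W∈S′ V∈S′

  -- The right inverse is the Schur
  -- complement formula above; applied to Mᵀ (whose pendant pair is the same) it yields
  -- a left inverse, and a matrix with a left and a right inverse is nonsingular.
  peel : ∀ S M {X Y} → S X ≡ true → S Y ≡ true → ¬ X ≡ Y →
    (∀ Z → S Z ≡ true → M Y Z ≡ (X ≐ Z)) → (∀ Z → S Z ≡ true → M Z Y ≡ (X ≐ Z)) →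
    Nonsingular (remove₂ S X Y) M → Nonsingular S M
  peel S M X∈S Y∈S X≢Y row-Y col-Y (N′ , MN′ , N′M) =
    extend , right-inverse MN′ , right-inverse-is-left S {M} {extend} {Q ᵀ} (right-inverse MN′) QᵀM
    where
    open PendantPair S M X∈S Y∈S X≢Y row-Y col-Y N′ using (extend; right-inverse)
    open PendantPair S (M ᵀ) X∈S Y∈S X≢Y col-Y row-Y (N′ ᵀ)
      using () renaming (extend to Q; right-inverse to right-inverseᵀ)
    QᵀM : RightInverseOn S (Q ᵀ) M
    QᵀM = transpose-inverse S {M ᵀ} {Q} (right-inverseᵀ (transpose-inverse (remove₂ S _ _) {N′} {M} N′M))


Triple : ℕ → ℕ → Set
Triple n m = Fin n × Fin m × Fin m

module _ {n m : ℕ} where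

  _≐₃_ : Triple n m → Triple n m → Bool
  (a , v , w) ≐₃ (a′ , v′ , w′) = ⌊ a ≟ a′ ⌋ ∧ (⌊ v ≟ v′ ⌋ ∧ ⌊ w ≟ w′ ⌋)

  ∑₃ : (Triple n m → Bool) → Bool
  ∑₃ f = ⊕Σ (λ a → ⊕Σ (λ v → ⊕Σ (λ w → f (a , v , w))))

  ∑₃-cong : ∀ {f g : Triple n m → Bool} → (∀ Z → f Z ≡ g Z) → ∑₃ f ≡ ∑₃ g
  ∑₃-cong f≗g = ⊕Σ-cong (λ a → ⊕Σ-cong (λ v → ⊕Σ-cong (λ w → f≗g (a , v , w))))

  ∑₃-xor : ∀ (f g : Triple n m → Bool) → ∑₃ (λ Z → f Z xor g Z) ≡ ∑₃ f xor ∑₃ g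
  ∑₃-xor f g =
    trans (⊕Σ-cong λ a → trans (⊕Σ-cong λ v → ⊕Σ-xor (λ w → f (a , v , w)) (λ w → g (a , v , w)))
                               (⊕Σ-xor (λ v → ⊕Σ (λ w → f (a , v , w))) (λ v → ⊕Σ (λ w → g (a , v , w)))))
          (⊕Σ-xor (λ a → ⊕Σ (λ v → ⊕Σ (λ w → f (a , v , w))))
                  (λ a → ⊕Σ (λ v → ⊕Σ (λ w → g (a , v , w)))))

  ∑₃-∧ˡ : ∀ b (f : Triple n m → Bool) → ∑₃ (λ Z → b ∧ f Z) ≡ b ∧ ∑₃ f
  ∑₃-∧ˡ b f =
    trans (⊕Σ-cong λ a → trans (⊕Σ-cong λ v → ⊕Σ-∧ˡ b (λ w → f (a , v , w)))
                               (⊕Σ-∧ˡ b (λ v → ⊕Σ (λ w → f (a , v , w)))))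
          (⊕Σ-∧ˡ b (λ a → ⊕Σ (λ v → ⊕Σ (λ w → f (a , v , w)))))

  ∑₃-⊕Σ : ∀ {k} (h : Triple n m → Fin k → Bool) →
    ∑₃ (λ Z → ⊕Σ (h Z)) ≡ ⊕Σ (λ i → ∑₃ (λ Z → h Z i))
  ∑₃-⊕Σ h =
    trans (⊕Σ-cong λ a → trans (⊕Σ-cong λ v → ⊕Σ-comm (λ w i → h (a , v , w) i))
                               (⊕Σ-comm (λ v i → ⊕Σ (λ w → h (a , v , w) i))))
          (⊕Σ-comm (λ a i → ⊕Σ (λ v → ⊕Σ (λ w → h (a , v , w) i))))

  ∑₃-comm : ∀ (h : Triple n m → Triple n m → Bool) →
    ∑₃ (λ Z → ∑₃ (λ Z′ → h Z Z′)) ≡ ∑₃ (λ Z′ → ∑₃ (λ Z → h Z Z′))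
  ∑₃-comm h =
    trans (∑₃-⊕Σ (λ Z a′ → ⊕Σ (λ v′ → ⊕Σ (λ w′ → h Z (a′ , v′ , w′)))))
          (⊕Σ-cong λ a′ → trans (∑₃-⊕Σ (λ Z v′ → ⊕Σ (λ w′ → h Z (a′ , v′ , w′))))
                                (⊕Σ-cong λ v′ → ∑₃-⊕Σ (λ Z w′ → h Z (a′ , v′ , w′))))

  ∑₃-delta : ∀ (X : Triple n m) (f : Triple n m → Bool) → ∑₃ (λ Z → (X ≐₃ Z) ∧ f Z) ≡ f X
  ∑₃-delta (a , v , w) f = begin
    ∑₃ (λ Z → ((a , v , w) ≐₃ Z) ∧ f Z)
      ≡⟨ ∑₃-cong (λ (a′ , v′ , w′) → ∧-assoc⁴ ⌊ a ≟ a′ ⌋ ⌊ v ≟ v′ ⌋ ⌊ w ≟ w′ ⌋ (f (a′ , v′ , w′))) ⟩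
    ⊕Σ (λ a′ → ⊕Σ (λ v′ → ⊕Σ (λ w′ → ⌊ a ≟ a′ ⌋ ∧ (⌊ v ≟ v′ ⌋ ∧ (⌊ w ≟ w′ ⌋ ∧ f (a′ , v′ , w′))))))
      ≡⟨ ⊕Σ-cong (λ a′ → ⊕Σ-cong λ v′ →
           trans (⊕Σ-∧ˡ ⌊ a ≟ a′ ⌋ (λ w′ → ⌊ v ≟ v′ ⌋ ∧ (⌊ w ≟ w′ ⌋ ∧ f (a′ , v′ , w′))))
                 (cong (⌊ a ≟ a′ ⌋ ∧_) (⊕Σ-delta-scaled ⌊ v ≟ v′ ⌋ w (λ w′ → f (a′ , v′ , w′))))) ⟩
    ⊕Σ (λ a′ → ⊕Σ (λ v′ → ⌊ a ≟ a′ ⌋ ∧ (⌊ v ≟ v′ ⌋ ∧ f (a′ , v′ , w))))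
      ≡⟨ ⊕Σ-cong (λ a′ → ⊕Σ-delta-scaled ⌊ a ≟ a′ ⌋ v (λ v′ → f (a′ , v′ , w))) ⟩
    ⊕Σ (λ a′ → ⌊ a ≟ a′ ⌋ ∧ f (a′ , v , w))
      ≡⟨ ⊕Σ-delta a (λ a′ → f (a′ , v , w)) ⟩
    f (a , v , w) ∎
    where
    open ≡-Reasoning
    ∧-assoc⁴ : ∀ p q r s → (p ∧ (q ∧ r)) ∧ s ≡ p ∧ (q ∧ (r ∧ s))
    ∧-assoc⁴ p q r s = trans (∧-assoc p (q ∧ r) s) (cong (p ∧_) (∧-assoc q r s))

  ≐₃-refl : ∀ X → (X ≐₃ X) ≡ true
  ≐₃-refl (a , v , w) rewrite ⌊≟⌋-refl a | ⌊≟⌋-refl v | ⌊≟⌋-refl w = refl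

  ≐₃-sound : ∀ {X Y} → (X ≐₃ Y) ≡ true → X ≡ Y
  ≐₃-sound {a , v , w} {a′ , v′ , w′} X≐Y with a ≟ a′ | v ≟ v′ | w ≟ w′ | X≐Y
  ... | yes refl | yes refl | yes refl | _ = refl
  ... | no _     | _        | _        | ()
  ... | yes _    | no _     | _        | ()
  ... | yes _    | yes _    | no _     | ()

tripleSummation : ∀ {n m} → GF2Summation (Triple n m)
tripleSummation = record
  { _≐_ = _≐₃_ ; ≐-refl = ≐₃-refl ; ≐-sound = ≐₃-sound
  ; ∑ = ∑₃ ; ∑-cong = ∑₃-cong ; ∑-xor = ∑₃-xor ; ∑-∧ˡ = ∑₃-∧ˡ ; ∑-comm = ∑₃-comm ; ∑-delta = ∑₃-delta
  }

𝟙 : Bool → ℕ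
𝟙 true = 1
𝟙 false = 0

𝟙-mono : ∀ {b c} → (b ≡ true → c ≡ true) → 𝟙 b ≤ 𝟙 c
𝟙-mono {false} _ = z≤n
𝟙-mono {true} b→c rewrite b→c refl = ≤-refl

𝟙-strict : ∀ {b c} → b ≡ false → c ≡ true → 𝟙 b < 𝟙 c
𝟙-strict refl refl = s≤s z≤n

sumℕ-mono : ∀ {k} {f g : Fin k → ℕ} → (∀ i → f i ≤ g i) → sumℕ f ≤ sumℕ g
sumℕ-mono {zero} f≤g = z≤n
sumℕ-mono {suc k} f≤g = +-mono-≤ (f≤g zero) (sumℕ-mono (λ i → f≤g (suc i)))

sumℕ-strict : ∀ {k} {f g : Fin k → ℕ} → (∀ i → f i ≤ g i) → ∀ i → f i < g i → sumℕ f < sumℕ g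
sumℕ-strict {suc k} f≤g zero f<g = +-mono-<-≤ f<g (sumℕ-mono (λ i → f≤g (suc i)))
sumℕ-strict {suc k} f≤g (suc i) f<g = +-mono-≤-< (f≤g zero) (sumℕ-strict (λ i → f≤g (suc i)) i f<g)

module TripleCounting {n m : ℕ} where
  open GF2Summation (tripleSummation {n} {m}) using (≐-refl)
  open MatrixAlgebra (tripleSummation {n} {m})

  size : Subset → ℕ
  size S = sumℕ (λ a → sumℕ (λ v → sumℕ (λ w → 𝟙 (S (a , v , w)))))

  size-strict : ∀ {S′ S} → (∀ Z → S′ Z ≡ true → S Z ≡ true) →
    ∀ X → S′ X ≡ false → S X ≡ true → size S′ < size S
  size-strict {S′} {S} S′⊆S (a , v , w) X∉S′ X∈S =
    sumℕ-strict {f = λ a → size₂ S′ a} {g = λ a → size₂ S a} (λ a → size₂-mono a) a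
      (sumℕ-strict {f = λ v → size₁ S′ a v} {g = λ v → size₁ S a v} (λ v → size₁-mono a v) v
        (sumℕ-strict {f = λ w → 𝟙 (S′ (a , v , w))} {g = λ w → 𝟙 (S (a , v , w))}
                     (λ w → 𝟙-mono (S′⊆S (a , v , w))) w
          (𝟙-strict X∉S′ X∈S)))
    where
    size₁ : Subset → Fin n → Fin m → ℕ
    size₁ S a v = sumℕ (λ w → 𝟙 (S (a , v , w)))
    size₂ : Subset → Fin n → ℕ
    size₂ S a = sumℕ (λ v → size₁ S a v)
    size₁-mono : ∀ a v → size₁ S′ a v ≤ size₁ S a v
    size₁-mono a v = sumℕ-mono (λ w → 𝟙-mono (S′⊆S (a , v , w)))
    size₂-mono : ∀ a → size₂ S′ a ≤ size₂ S a
    size₂-mono a = sumℕ-mono (size₁-mono a)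

  size-remove₂ : ∀ S {X Y} → S X ≡ true → size (remove₂ S X Y) < size S
  size-remove₂ S {X} {Y} X∈S =
    size-strict (λ Z Z∈S′ → proj₁ (remove₂-elim S {X} {Y} {Z} Z∈S′)) X X∉S′ X∈S
    where
    X∉S′ : remove₂ S X Y X ≡ false
    X∉S′ rewrite ≐-refl X = ∧-zeroʳ (S X)

  any₃? : (P : Triple n m → Set) → (∀ Z → Dec (P Z)) → Dec (Σ (Triple n m) P)
  any₃? P P? = map′ (λ (a , v , w , p) → (a , v , w) , p) (λ ((a , v , w) , p) → a , v , w , p)
                    (any? λ a → any? λ v → any? λ w → P? (a , v , w))

  all₃? : (P : Triple n m → Set) → (∀ Z → Dec (P Z)) → Dec (∀ Z → P Z)
  all₃? P P? = map′ (λ all (a , v , w) → all a v w) (λ all a v w → all (a , v , w))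
                    (all? λ a → all? λ v → all? λ w → P? (a , v , w))

module Elimination {n m : ℕ} (M : Triple n m → Triple n m → Bool) (pair : Triple n m → Triple n m)
  (S₀ : Triple n m → Bool)
  (pair-involutive : ∀ Z → pair (pair Z) ≡ Z)
  (pair-fixfree : ∀ Z → S₀ Z ≡ true → ¬ pair Z ≡ Z)
  (M-symmetric : ∀ Y Z → S₀ Y ≡ true → S₀ Z ≡ true → M Y Z ≡ M Z Y) where
  open GF2Summation (tripleSummation {n} {m}) using (_≐_)
  open MatrixAlgebra (tripleSummation {n} {m})
  open TripleCounting {n} {m}

  Admissible : Subset → Set
  Admissible S = (∀ Z → S Z ≡ true → S₀ Z ≡ true) × (∀ Z → S Z ≡ true → S (pair Z) ≡ true)

  Pendant : Subset → Triple n m → Set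
  Pendant S Y = (S Y ≡ true) × (∀ Z → S Z ≡ true → M Y Z ≡ (pair Y ≐ Z))

  pendant? : ∀ S Y → Dec (Pendant S Y)
  pendant? S Y = (S Y ≟ᵇ true) ×-dec all₃? _ (λ Z → (S Z ≟ᵇ true) →-dec (M Y Z ≟ᵇ (pair Y ≐ Z)))

  remove-pair : ∀ S Y → Admissible S → Admissible (remove₂ S (pair Y) Y)
  remove-pair S Y (S⊆S₀ , closed) = (λ Z Z∈S′ → S⊆S₀ Z (proj₁ (remove₂-elim S {pair Y} {Y} {Z} Z∈S′))) , closed′
    where
    closed′ : ∀ Z → remove₂ S (pair Y) Y Z ≡ true → remove₂ S (pair Y) Y (pair Z) ≡ true
    closed′ Z Z∈S′ with remove₂-elim S {pair Y} {Y} {Z} Z∈S′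
    ... | Z∈S , pY≢Z , Y≢Z =
      remove₂-intro S (closed Z Z∈S)
        (λ pY≡pZ → Y≢Z (trans (sym (pair-involutive Y)) (trans (cong pair pY≡pZ) (pair-involutive Z))))
        (λ Y≡pZ → pY≢Z (trans (cong pair Y≡pZ) (pair-involutive Z)))

  eliminate : (∀ S → Admissible S → ∀ Z → S Z ≡ true → ¬ ¬ Σ (Triple n m) (Pendant S)) →
    ∀ S → Admissible S → Nonsingular S M
  eliminate has-pendant S = by-size (suc (size S)) S (n<1+n (size S))
    where
    by-size : ∀ k S → size S < k → Admissible S → Nonsingular S M
    by-size (suc k) S (s≤s size≤k) adm@(S⊆S₀ , closed) with any₃? (Pendant S) (pendant? S)
    ... | yes (Y , Y∈S , row-Y) =
      peel S M (closed Y Y∈S) Y∈S (pair-fixfree Y (S⊆S₀ Y Y∈S)) row-Y col-Y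
        (by-size k (remove₂ S (pair Y) Y) (<-≤-trans (size-remove₂ S {pair Y} {Y} (closed Y Y∈S)) size≤k) (remove-pair S Y adm))
      where
      col-Y : ∀ Z → S Z ≡ true → M Z Y ≡ (pair Y ≐ Z)
      col-Y Z Z∈S = trans (M-symmetric Z Y (S⊆S₀ Z Z∈S) (S⊆S₀ Y Y∈S)) (row-Y Z Z∈S)
    ... | no no-pendant with any₃? (λ Z → S Z ≡ true) (λ Z → S Z ≟ᵇ true)
    ...   | yes (Z , Z∈S) = ⊥-elim (has-pendant S adm Z Z∈S no-pendant)
    ...   | no empty = (λ _ _ → false) , vacuous M _ , vacuous _ M
      where
      vacuous : ∀ A B → RightInverseOn S A B
      vacuous A B X _ X∈S _ = ⊥-elim (empty (X , X∈S))

Reach-map : ∀ {k} {R R′ : Fin k → Fin k → Set} → (∀ {p q} → R p q → R′ p q) →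
  ∀ {s t} → Reach R s t → Reach R′ s t
Reach-map f here = here
Reach-map f (step r walk) = step (f r) (Reach-map f walk)

module Orientation {n m : ℕ} (G : Mat n) (T : Mat m) (L : Fin n → Fin m) (x : Fin m) where
  open Expansion G T L x

  Without : (Fin m → Fin m → Set) → Fin m → Fin m → Fin m → Fin m → Set
  Without R v w p q = R p q × ¬ SameEdge v w p q

  sameEdge? : ∀ v w p q → Dec (SameEdge v w p q)
  sameEdge? v w p q = (p ≟ v ×-dec q ≟ w) ⊎-dec (p ≟ w ×-dec q ≟ v)

  last-use : ∀ {R} v w {s t} → Reach R s t →
    Reach (Without R v w) s t ⊎ Reach (Without R v w) v t ⊎ Reach (Without R v w) w t
  last-use v w here = inj₁ here
  last-use v w (step {s} {s′} r walk) with last-use v w walk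
  ... | inj₂ suffix = inj₂ suffix
  ... | inj₁ avoiding with sameEdge? v w s s′
  ...   | yes (inj₁ (_ , refl)) = inj₂ (inj₂ avoiding)
  ...   | yes (inj₂ (_ , refl)) = inj₂ (inj₁ avoiding)
  ...   | no ¬vw = inj₁ (step (r , ¬vw) avoiding)

  InTe-sym : ∀ {v w t} → InTe v w t → InTe w v t
  InTe-sym cut walk = cut (Reach-map (λ (r , ¬wv) → r , λ vw → ¬wv (swap vw)) walk)

  module _ (connected : Connected T) where

    not-both-ends : ∀ {v w} → InTe v w v → InTe v w w → ⊥
    not-both-ends {v} {w} v-cut w-cut with last-use {Adj T} v w (connected v x)
    ... | inj₁ walk = v-cut walk
    ... | inj₂ (inj₁ walk) = v-cut walk
    ... | inj₂ (inj₂ walk) = w-cut walk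

    out-antisym : ∀ {v w} → Out v w → Out w v → ⊥
    out-antisym (_ , w-cut) (_ , v-cut) = not-both-ends (InTe-sym v-cut) w-cut

    tail-not-below : ∀ {v w} → Out v w → InTe v w v → ⊥
    tail-not-below (_ , w-cut) v-cut = not-both-ends v-cut w-cut

    below-child : ∀ {u v u′} → Out u v → Out v u′ → ∀ {t} → InTe v u′ t → InTe u v t
    below-child {u} {v} {u′} (_ , v-cut) (_ , u′-cut) t-cut walk with last-use {TMinus u v} v u′ walk
    ... | inj₁ avoiding = t-cut (Reach-map (λ ((r , _) , ¬vu′) → r , ¬vu′) avoiding)
    ... | inj₂ (inj₁ from-v) = v-cut (Reach-map proj₁ from-v)
    ... | inj₂ (inj₂ from-u′) = u′-cut (Reach-map (λ ((r , _) , ¬vu′) → r , ¬vu′) from-u′)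

    module Measure (below? : ∀ v w t → Dec (InTe v w t)) where

      μ : Fin m → Fin m → ℕ
      μ v w = sumℕ (λ t → 𝟙 (does (below? v w t)))

      μ-step : ∀ {u v u′} → Out u v → Out v u′ → μ v u′ < μ u v
      μ-step {u} {v} {u′} uv vu′ =
        sumℕ-strict
          (λ t → 𝟙-mono (λ below → dec-true (below? u v t) (below-child uv vu′ (dec-true⁻ below))))
          v (𝟙-strict (dec-false (below? v u′ v) (tail-not-below vu′)) (dec-true (below? u v v) (proj₂ uv)))
        where
        dec-true⁻ : ∀ {t} → does (below? v u′ t) ≡ true → InTe v u′ t
        dec-true⁻ {t} with below? v u′ t
        ... | yes below = λ _ → below
        ... | no _ = λ ()

¬¬-Π : ∀ {k} {P : Fin k → Set} → (∀ i → ¬ ¬ P i) → ¬ ¬ (∀ i → P i)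
¬¬-Π {zero} _ ¬all = ¬all (λ ())
¬¬-Π {suc k} {P} ¬¬P ¬all =
  ¬¬P zero λ P0 → ¬¬-Π {k} {λ i → P (suc i)} (λ i → ¬¬P (suc i))
    λ Psuc → ¬all λ { zero → P0 ; (suc i) → Psuc i }

-- Only the shape of the adjacency rules
-- matters: rule (a) pairs (a , e , v) with its partner (a , e , w), and rules (b), (c) only join
-- copies at a common vertex v, each involving an edge oriented away from v.
module RankExpansion {n m : ℕ} (G : Mat n) (T : Mat m) (L : Fin n → Fin m) (x : Fin m)
  (T-simple : IsSimpleGraph T) (T-connected : Connected T)
  (U : Fin m → Fin m → Fin n → Bool) (U-sym : ∀ v w → T v w ≡ true → ∀ a → U v w a ≡ U w v a)
  (P : Fin m → Fin m → Fin n → Fin n → Bool)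
  (AH : Triple n m → Triple n m → Bool) (AH-adj : Expansion.IsAdjMatrixOnEbar G T L x U P AH) where
  open Expansion G T L x using (Out; InTe; inEbar; HAdj)
  open Orientation G T L x
  open GF2Summation (tripleSummation {n} {m}) using (_≐_; ≐-sound)
  open MatrixAlgebra (tripleSummation {n} {m}) using (Subset; ≐-false⁻)

  Ē : Subset
  Ē = inEbar U P

  partner : Triple n m → Triple n m
  partner (a , v , w) = (a , w , v)

  Ē-facts : ∀ {a v w} → Ē (a , v , w) ≡ true →
    (T v w ≡ true) × (isInner T v ≡ true) × (isInner T w ≡ true) × (U v w a ≡ true)
  Ē-facts {a} {v} {w} ∈Ē =
    ∧-conicalˡ (T v w) _ ∈Ē , ∧-conicalˡ (isInner T v) _ inner-v ,
    ∧-conicalˡ (isInner T w) _ inner-w , ∧-conicalʳ (isInner T w) (U v w a) inner-w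
    where
    inner-v = ∧-conicalʳ (T v w) (isInner T v ∧ (isInner T w ∧ U v w a)) ∈Ē
    inner-w = ∧-conicalʳ (isInner T v) (isInner T w ∧ U v w a) inner-v

  -- Ē is closed under taking partners, since T and U_e are symmetric in the ends of e
  Ē-closed : ∀ Z → Ē Z ≡ true → Ē (partner Z) ≡ true
  Ē-closed (a , v , w) ∈Ē with Ē-facts ∈Ē
  ... | vw , v-inner , w-inner , a∈U
    rewrite proj₁ T-simple w v | vw | v-inner | w-inner | sym (U-sym v w vw a) | a∈U = refl

  -- partners are distinct because T has no loops
  partner-fixfree : ∀ Z → Ē Z ≡ true → ¬ partner Z ≡ Z
  partner-fixfree (a , v , w) ∈Ē same with Ē-facts ∈Ē | same
  ... | vw , _ | refl = true≢false (trans (sym vw) (proj₂ T-simple v))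

  HAdj-sym : ∀ {X Y} → HAdj U P X Y → HAdj U P Y X
  HAdj-sym (inj₁ r) = inj₂ (inj₁ r)
  HAdj-sym (inj₂ (inj₁ r)) = inj₁ r
  HAdj-sym (inj₂ (inj₂ (inj₁ r))) = inj₂ (inj₂ (inj₂ (inj₁ r)))
  HAdj-sym (inj₂ (inj₂ (inj₂ (inj₁ r)))) = inj₂ (inj₂ (inj₁ r))
  HAdj-sym (inj₂ (inj₂ (inj₂ (inj₂ (inj₁ r))))) = inj₂ (inj₂ (inj₂ (inj₂ (inj₂ r))))
  HAdj-sym (inj₂ (inj₂ (inj₂ (inj₂ (inj₂ r))))) = inj₂ (inj₂ (inj₂ (inj₂ (inj₁ r))))

  AH-sym : ∀ Y Z → Ē Y ≡ true → Ē Z ≡ true → AH Y Z ≡ AH Z Y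
  AH-sym Y Z Y∈Ē Z∈Ē = ⇔→≡ (mk⇔ (transfer Y∈Ē Z∈Ē) (transfer Z∈Ē Y∈Ē))
    where
    transfer : ∀ {Y Z} → Ē Y ≡ true → Ē Z ≡ true → AH Y Z ≡ true → AH Z Y ≡ true
    transfer {Y} {Z} Y∈Ē Z∈Ē YZ = proj₂ (AH-adj Z Y Z∈Ē Y∈Ē) (HAdj-sym (proj₁ (AH-adj Y Z Y∈Ē Z∈Ē) YZ))

  head-neighbour : ∀ {a v w a′ v′ w′} → ¬ Out v w → HAdj U P (a , v , w) (a′ , v′ , w′) →
    ((a′ , v′ , w′) ≡ (a , w , v)) ⊎ ((v′ ≡ v) × Out w v × Out v w′)
  head-neighbour ¬out (inj₁ (refl , refl , refl , _)) = inj₁ refl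
  head-neighbour ¬out (inj₂ (inj₁ (refl , refl , refl , _))) = inj₁ refl
  head-neighbour ¬out (inj₂ (inj₂ (inj₁ (refl , wv , vw′ , _)))) = inj₂ (refl , wv , vw′)
  head-neighbour ¬out (inj₂ (inj₂ (inj₂ (inj₁ (refl , _ , vw , _))))) = ⊥-elim (¬out vw)
  head-neighbour ¬out (inj₂ (inj₂ (inj₂ (inj₂ (inj₁ (refl , _ , vw , _)))))) = ⊥-elim (¬out vw)
  head-neighbour ¬out (inj₂ (inj₂ (inj₂ (inj₂ (inj₂ (refl , _ , _ , vw , _)))))) = ⊥-elim (¬out vw)

  open Elimination AH partner Ē (λ _ → refl) partner-fixfree AH-sym public

  -- Suppose S has no pendant element and membership in the subtrees T_vw is decided.  Then a
  -- copy (a , e , v) ∈ S at an end v that is not the tail of e is not pendant, so it has a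
  -- rule-(b) neighbour (b , f , v) ∈ S with f = vu′ oriented away from v; the partner
  -- (b , f , u′) is a copy of the same kind, strictly deeper in the tree.  Hence there is none.
  module Descent (S : Subset) (adm : Admissible S) (no-pendant : ¬ Σ (Triple n m) (Pendant S))
    (below? : ∀ v w t → Dec (InTe v w t)) where
    open Measure T-connected below?

    descend : ∀ k a v w → S (a , v , w) ≡ true → ¬ Out v w → μ w v < k → ⊥
    descend (suc k) a v w Y∈S ¬out (s≤s μ≤k) = no-pendant ((a , v , w) , Y∈S , row)
      where
      Y∈Ē : Ē (a , v , w) ≡ true
      Y∈Ē = proj₁ adm (a , v , w) Y∈S
      row : ∀ Z → S Z ≡ true → AH (a , v , w) Z ≡ ((a , w , v) ≐ Z)
      row Z@(b , v′ , u′) Z∈S with (a , w , v) ≐ Z in partner≐Z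
      ... | true with ≐-sound {a , w , v} {Z} partner≐Z
      ...   | refl = proj₂ (AH-adj _ _ Y∈Ē (proj₁ adm _ Z∈S)) (inj₁ (refl , refl , refl , Ē-facts Y∈Ē))
      row Z@(b , v′ , u′) Z∈S | false with AH (a , v , w) Z in edge
      ...   | false = refl
      ...   | true with head-neighbour ¬out (proj₁ (AH-adj _ _ Y∈Ē (proj₁ adm Z Z∈S)) edge)
      ...     | inj₁ refl = ⊥-elim (≐-false⁻ {Z} {Z} partner≐Z refl)
      ...     | inj₂ (refl , wv , vu′) =
        ⊥-elim (descend k b u′ v (proj₂ adm Z Z∈S) (out-antisym T-connected vu′)
                        (<-≤-trans (μ-step wv vu′) μ≤k))

    -- of a copy and its partner, at least one sits at an end that is not the tail of the edge
    no-element : ∀ Z → S Z ≡ true → ⊥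
    no-element (a , v , w) Z∈S with (T v w ≟ᵇ true) ×-dec below? v w w
    ... | yes out = descend (suc (μ v w)) a w v (proj₂ adm _ Z∈S) (out-antisym T-connected out) (n<1+n (μ v w))
    ... | no ¬out = descend (suc (μ w v)) a v w Z∈S ¬out (n<1+n (μ w v))

  -- every nonempty admissible set has a pendant element, classically: the goal is negative,
  -- so membership in the subtrees may be assumed decidable
  pendant-exists : ∀ S → Admissible S → ∀ Z → S Z ≡ true → ¬ ¬ Σ (Triple n m) (Pendant S)
  pendant-exists S adm Z Z∈S no-pendant =
    ¬¬-Π (λ v → ¬¬-Π (λ w → ¬¬-Π (λ t → ¬¬-excluded-middle)))
      (λ below? → Descent.no-element S adm no-pendant below? Z Z∈S)

-- Lemma 3.5: the pendant-pair elimination applies to A(H) on Ē with the partner involution.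
lemma3p5 : ∀ {n m : ℕ} (G : Mat n) → IsSimpleGraph G → Connected G → 3 ≤ n →
    (T : Mat m) (L : Fin n → Fin m) → IsRankDecomposition G T L →
    (x : Fin m) → isLeaf T x ≡ true →
    (U : Fin m → Fin m → Fin n → Bool) → Expansion.ValidU G T L x U →
    (P : Fin m → Fin m → Fin n → Fin n → Bool) → Expansion.ValidP G T L x U P →
    (AH : Expansion.Triple G T L x → Expansion.Triple G T L x → Bool) →
    Expansion.IsAdjMatrixOnEbar G T L x U P AH →
    Expansion.NonsingularOn G T L x (Expansion.inEbar G T L x U P) AH
lemma3p5 G _ _ _ T L (((T-simple , T-connected , _) , _) , _) x _ U (U-sym , _) P _ AH AH-adj =
  eliminate pendant-exists Ē ((λ _ Z∈Ē → Z∈Ē) , Ē-closed)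
  where open RankExpansion G T L x T-simple T-connected U U-sym P AH AH-adj
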